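{- Every nonsingular real symmetric $n\times n$ matrix $A$ has the $i$-SNIP for each index $i\in[n]$.
   Context: $A$ has the $i$-SNIP if $X=O$ is the only real symmetric matrix $X$ with $A\circ X=O$, $I\circ X=O$ ($\circ$ the entrywise product) and $(AX)(i,:]=O$, where $(AX)(i,:]$ is $AX$ with row $i$ deleted. -}

module Defs where

open import Level using (0ℓ)
open import Data.Nat using (ℕ; zero; suc)
open import Data.Fin using (Fin; zero; suc)
open import Data.Product using (Σ; ∃; _×_; _,_)
open import Relation.Binary.PropositionalEquality using (_≡_; _≢_)
open import Relation.Binary.Structures using (IsTotalOrder)
open import Algebra.Structures using (IsCommutativeRing)
open import Relation.Nullary using (yes; no)
open import Data.Fin using (_≟_)

-- The real numbers, axiomatised (up to isomorphism) as a Dedekind-complete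
-- ordered field.
record RealField : Set₁ where
  infixl 6 _+_
  infixl 7 _*_
  infix 4 _≤_
  field
    Carrier : Set
    _+_ _*_ : Carrier → Carrier → Carrier
    -_      : Carrier → Carrier
    0# 1#   : Carrier
    _≤_     : Carrier → Carrier → Set
    isCommutativeRing : IsCommutativeRing _≡_ _+_ _*_ -_ 0# 1#
    0≢1     : 0# ≢ 1#
    inverse : ∀ x → x ≢ 0# → ∃ λ y → x * y ≡ 1#
    isTotalOrder : IsTotalOrder _≡_ _≤_
    +-mono-≤ : ∀ {x y} z → x ≤ y → x + z ≤ y + z
    *-nonneg : ∀ {x y} → 0# ≤ x → 0# ≤ y → 0# ≤ x * y
    complete : (P : Carrier → Set) → ∃ P → (∃ λ b → ∀ x → P x → x ≤ b) →
               ∃ λ s → (∀ x → P x → x ≤ s) × (∀ b → (∀ x → P x → x ≤ b) → s ≤ b)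

module Matrices (ℝ : RealField) where
  open RealField ℝ

  Matrix : ℕ → Set
  Matrix n = Fin n → Fin n → Carrier

  Σ[_] : ∀ n → (Fin n → Carrier) → Carrier
  Σ[ zero ] f = 0#
  Σ[ suc n ] f = f zero + Σ[ n ] (λ k → f (suc k))

  _·_ : ∀ {n} → Matrix n → Matrix n → Matrix n
  _·_ {n} A B j k = Σ[ n ] (λ l → A j l * B l k)

  _∘_ : ∀ {n} → Matrix n → Matrix n → Matrix n
  (A ∘ B) j k = A j k * B j k

  O : ∀ {n} → Matrix n
  O j k = 0#

  I : ∀ {n} → Matrix n
  I j k with j ≟ k
  ... | yes _ = 1#
  ... | no _ = 0#

  _≈_ : ∀ {n} → Matrix n → Matrix n → Set
  A ≈ B = ∀ j k → A j k ≡ B j k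

  Symmetric : ∀ {n} → Matrix n → Set
  Symmetric A = ∀ j k → A j k ≡ A k j

  Nonsingular : ∀ {n} → Matrix n → Set
  Nonsingular {n} A = Σ (Matrix n) λ B → ((A · B) ≈ I) × ((B · A) ≈ I)

  RowsExcept_Zero : ∀ {n} → Fin n → Matrix n → Set
  RowsExcept_Zero i M = ∀ j → j ≢ i → ∀ k → M j k ≡ 0#

  HasSNIP : ∀ {n} → Matrix n → Fin n → Set
  HasSNIP {n} A i = (X : Matrix n) → Symmetric X → (A ∘ X) ≈ O → (I ∘ X) ≈ O →
                    RowsExcept i Zero (A · X) → X ≈ O

-- Since B A = I and every row of A X other than row i vanishes, X = B (A X) is the rank-one
-- matrix b mᵀ, where b is column i of B and m is row i of A X.  The zero diagonal of X gives
-- b j m j = 0, so by symmetry X j k ² = X j k X k j = (b j m j) (b k m k) = 0, and a real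
-- number whose square is zero is zero.
module Submission where

open import Defs
open import Level using (0ℓ)
open import Data.Nat using (ℕ; zero; suc)
open import Data.Fin using (Fin; zero; suc; _≟_)
open import Data.Fin.Properties using (suc-injective)
open import Data.Product using (_,_; proj₁; proj₂)
open import Data.Sum using (inj₁; inj₂)
open import Data.Empty using (⊥-elim)
open import Relation.Nullary using (yes; no)
open import Relation.Binary.PropositionalEquality
  using (_≡_; _≢_; refl; sym; trans; cong; cong₂; subst; subst₂; module ≡-Reasoning)
open import Relation.Binary.Structures using (IsTotalOrder)
open import Algebra.Bundles using (CommutativeRing)
import Algebra.Properties.Ring as RingProperties
import Algebra.Properties.CommutativeSemigroup as CommutativeSemigroupProperties
import Algebra.Properties.Semiring.Sum as SemiringSum

module OrderedFieldProperties (ℝ : RealField) where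
  open RealField ℝ
  open ≡-Reasoning

  commutativeRing : CommutativeRing 0ℓ 0ℓ
  commutativeRing = record { isCommutativeRing = isCommutativeRing }

  open CommutativeRing commutativeRing
    using (+-assoc; +-identityˡ; +-identityʳ; -‿inverseˡ; -‿inverseʳ;
           *-identityˡ; *-identityʳ; distribˡ; distribʳ; zeroˡ)
  open RingProperties (CommutativeRing.ring commutativeRing)
    using (-‿involutive; -‿distribˡ-*; -‿distribʳ-*)
  open IsTotalOrder isTotalOrder using (total; antisym) renaming (trans to ≤-trans)

  x+y-y≡x : ∀ x y → x + y + - y ≡ x
  x+y-y≡x x y = begin
    x + y + - y    ≡⟨ +-assoc x y (- y) ⟩
    x + (y + - y)  ≡⟨ cong (x +_) (-‿inverseʳ y) ⟩
    x + 0#         ≡⟨ +-identityʳ x ⟩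
    x              ∎

  x-y+y≡x : ∀ x y → x + - y + y ≡ x
  x-y+y≡x x y = begin
    x + - y + y    ≡⟨ +-assoc x (- y) y ⟩
    x + (- y + y)  ≡⟨ cong (x +_) (-‿inverseˡ y) ⟩
    x + 0#         ≡⟨ +-identityʳ x ⟩
    x              ∎

  -x*-x≡x*x : ∀ x → - x * - x ≡ x * x
  -x*-x≡x*x x = begin
    - x * - x      ≡⟨ -‿distribˡ-* x (- x) ⟨
    - (x * - x)    ≡⟨ cong -_ (-‿distribʳ-* x x) ⟨
    - - (x * x)    ≡⟨ -‿involutive (x * x) ⟩
    x * x          ∎

  +-cancelʳ-≤ : ∀ {x y} z → x + z ≤ y + z → x ≤ y
  +-cancelʳ-≤ {x} {y} z x+z≤y+z =
    subst₂ _≤_ (x+y-y≡x x z) (x+y-y≡x y z) (+-mono-≤ (- z) x+z≤y+z)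

  x≤y⇒0≤y-x : ∀ {x y} → x ≤ y → 0# ≤ y + - x
  x≤y⇒0≤y-x {x} x≤y = subst (_≤ _) (-‿inverseʳ x) (+-mono-≤ (- x) x≤y)

  0≤y-x⇒x≤y : ∀ {x y} → 0# ≤ y + - x → x ≤ y
  0≤y-x⇒x≤y {x} {y} 0≤y-x = subst₂ _≤_ (+-identityˡ x) (x-y+y≡x y x) (+-mono-≤ x 0≤y-x)

  *-monoˡ-≤-nonNeg : ∀ {x y} z → 0# ≤ z → x ≤ y → x * z ≤ y * z
  *-monoˡ-≤-nonNeg {x} {y} z 0≤z x≤y =
    0≤y-x⇒x≤y (subst (0# ≤_) [y-x]z≡yz-xz (*-nonneg (x≤y⇒0≤y-x x≤y) 0≤z))
    where
    [y-x]z≡yz-xz : (y + - x) * z ≡ y * z + - (x * z)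
    [y-x]z≡yz-xz = trans (distribʳ z y (- x)) (cong (y * z +_) (sym (-‿distribˡ-* x z)))

  0≤1 : 0# ≤ 1#
  0≤1 with total 0# 1#
  ... | inj₁ 0≤1 = 0≤1
  ... | inj₂ 1≤0 = subst (0# ≤_) (trans (-x*-x≡x*x 1#) (*-identityˡ 1#)) (*-nonneg 0≤-1 0≤-1)
    where
    0≤-1 : 0# ≤ - 1#
    0≤-1 = subst (0# ≤_) (+-identityˡ (- 1#)) (x≤y⇒0≤y-x 1≤0)

  1+1≢0 : 1# + 1# ≢ 0#
  1+1≢0 1+1≡0 = 0≢1 (antisym 0≤1 (subst₂ _≤_ (+-identityˡ 1#) 1+1≡0 (+-mono-≤ 1# 0≤1)))

  ½ : Carrier
  ½ = proj₁ (inverse (1# + 1#) 1+1≢0)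

  ½+½≡1 : ½ + ½ ≡ 1#
  ½+½≡1 = begin
    ½ + ½              ≡⟨ cong₂ _+_ (*-identityˡ ½) (*-identityˡ ½) ⟨
    1# * ½ + 1# * ½    ≡⟨ distribʳ ½ 1# 1# ⟨
    (1# + 1#) * ½      ≡⟨ proj₂ (inverse (1# + 1#) 1+1≢0) ⟩
    1#                 ∎

  0≤½ : 0# ≤ ½
  0≤½ with total 0# ½
  ... | inj₁ 0≤½ = 0≤½
  ... | inj₂ ½≤0 = ⊥-elim (0≢1 (antisym 0≤1 1≤0))
    where
    1≤0 : 1# ≤ 0#
    1≤0 = ≤-trans (subst₂ _≤_ ½+½≡1 (+-identityˡ ½) (+-mono-≤ ½ ½≤0)) ½≤0

  x*½+x*½≡x : ∀ x → x * ½ + x * ½ ≡ x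
  x*½+x*½≡x x = trans (sym (distribˡ x ½ ½)) (trans (cong (x *_) ½+½≡1) (*-identityʳ x))

  SquareZero : Carrier → Set
  SquareZero x = x * x ≡ 0#

  squareZero⇒≤1 : ∀ x → SquareZero x → x ≤ 1#
  squareZero⇒≤1 x x²≡0 with total x 1#
  ... | inj₁ x≤1 = x≤1
  ... | inj₂ 1≤x = ≤-trans (subst₂ _≤_ (*-identityˡ x) x²≡0 1x≤xx) 0≤1
    where
    1x≤xx : 1# * x ≤ x * x
    1x≤xx = *-monoˡ-≤-nonNeg x (≤-trans 0≤1 1≤x) 1≤x

  squareZero-double : ∀ {x} → SquareZero x → SquareZero (x + x)
  squareZero-double {x} x²≡0 = begin
    (x + x) * (x + x)                   ≡⟨ distribʳ (x + x) x x ⟩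
    x * (x + x) + x * (x + x)           ≡⟨ cong (λ y → y + y) (distribˡ x x x) ⟩
    (x * x + x * x) + (x * x + x * x)   ≡⟨ cong (λ y → (y + y) + (y + y)) x²≡0 ⟩
    (0# + 0#) + (0# + 0#)               ≡⟨ cong (λ y → y + y) (+-identityˡ 0#) ⟩
    0# + 0#                             ≡⟨ +-identityˡ 0# ⟩
    0#                                  ∎

  -- Inverses only refute x ≢ 0#, and equality is not decidable, so completeness is used:
  -- doubling preserves SquareZero, hence any upper bound s of the square-zero elements also
  -- bounds them by s ½, and for the least one s ≤ s ½.
  squareZero-lub≤0 : ∀ s → (∀ x → SquareZero x → x ≤ s) →
                     (∀ b → (∀ x → SquareZero x → x ≤ b) → s ≤ b) → s ≤ 0#
  squareZero-lub≤0 s upper least = ≤-trans s≤s½ s½≤0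
    where
    ≤s½ : ∀ t → SquareZero t → t ≤ s * ½
    ≤s½ t t²≡0 = subst (_≤ s * ½) [t+t]½≡t
      (*-monoˡ-≤-nonNeg ½ 0≤½ (upper (t + t) (squareZero-double t²≡0)))
      where
      [t+t]½≡t : (t + t) * ½ ≡ t
      [t+t]½≡t = trans (distribʳ ½ t t) (x*½+x*½≡x t)

    s≤s½ : s ≤ s * ½
    s≤s½ = least (s * ½) ≤s½

    s½≤0 : s * ½ ≤ 0#
    s½≤0 = +-cancelʳ-≤ (s * ½)
      (subst₂ _≤_ (sym (x*½+x*½≡x s)) (sym (+-identityˡ (s * ½))) s≤s½)

  squareZero⇒≤0 : ∀ {x} → SquareZero x → x ≤ 0#
  squareZero⇒≤0 {x} x²≡0 =
    let (s , upper , least) = complete SquareZero (0# , zeroˡ 0#) (1# , squareZero⇒≤1)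
    in ≤-trans (upper x x²≡0) (squareZero-lub≤0 s upper least)

  squareZero⇒≡0 : ∀ {x} → SquareZero x → x ≡ 0#
  squareZero⇒≡0 {x} x²≡0 = antisym (squareZero⇒≤0 x²≡0) 0≤x
    where
    -x≤0 : - x ≤ 0#
    -x≤0 = squareZero⇒≤0 (trans (-x*-x≡x*x x) x²≡0)
    0≤x : 0# ≤ x
    0≤x = subst (0# ≤_) (trans (+-identityˡ (- - x)) (-‿involutive x)) (x≤y⇒0≤y-x -x≤0)

module MatrixProperties (ℝ : RealField) where
  open RealField ℝ
  open Matrices ℝ
  open OrderedFieldProperties ℝ using (commutativeRing; squareZero⇒≡0)
  open CommutativeRing commutativeRing
    using (+-identityˡ; +-identityʳ; *-identityˡ; *-assoc; *-comm; zeroˡ; zeroʳ)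
  open SemiringSum (CommutativeRing.semiring commutativeRing)
    using (sum; sum-cong-≗; sum-replicate-zero; ∑-comm; *-distribˡ-sum; *-distribʳ-sum)
  open CommutativeSemigroupProperties (CommutativeRing.*-commutativeSemigroup commutativeRing)
    using (interchange)
  open ≡-Reasoning

  Σ≡sum : ∀ n (f : Fin n → Carrier) → Σ[ n ] f ≡ sum f
  Σ≡sum zero f = refl
  Σ≡sum (suc n) f = cong (f zero +_) (Σ≡sum n (λ k → f (suc k)))

  Σ-cong : ∀ n {f g : Fin n → Carrier} → (∀ k → f k ≡ g k) → Σ[ n ] f ≡ Σ[ n ] g
  Σ-cong n {f} {g} f≗g = trans (Σ≡sum n f) (trans (sum-cong-≗ f≗g) (sym (Σ≡sum n g)))

  Σ-zero : ∀ n {f : Fin n → Carrier} → (∀ k → f k ≡ 0#) → Σ[ n ] f ≡ 0#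
  Σ-zero n f≡0 = trans (Σ-cong n f≡0) (trans (Σ≡sum n _) (sum-replicate-zero n))

  Σ-supportedAt : ∀ n (f : Fin n → Carrier) j → (∀ k → k ≢ j → f k ≡ 0#) → Σ[ n ] f ≡ f j
  Σ-supportedAt (suc n) f zero f≡0 = begin
    f zero + Σ[ n ] (λ k → f (suc k))  ≡⟨ cong (f zero +_) (Σ-zero n (λ k → f≡0 (suc k) λ ())) ⟩
    f zero + 0#                        ≡⟨ +-identityʳ (f zero) ⟩
    f zero                             ∎
  Σ-supportedAt (suc n) f (suc j) f≡0 = begin
    f zero + Σ[ n ] (λ k → f (suc k))  ≡⟨ cong₂ _+_ (f≡0 zero λ ()) (Σ-supportedAt n _ j f∘suc≡0) ⟩
    0# + f (suc j)                     ≡⟨ +-identityˡ (f (suc j)) ⟩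
    f (suc j)                          ∎
    where
    f∘suc≡0 : ∀ k → k ≢ j → f (suc k) ≡ 0#
    f∘suc≡0 k k≢j = f≡0 (suc k) (λ sk≡sj → k≢j (suc-injective sk≡sj))

  I-diag : ∀ {n} (j : Fin n) → I j j ≡ 1#
  I-diag j with j ≟ j
  ... | yes _ = refl
  ... | no j≢j = ⊥-elim (j≢j refl)

  I-offDiag : ∀ {n} {j k : Fin n} → j ≢ k → I j k ≡ 0#
  I-offDiag {j = j} {k} j≢k with j ≟ k
  ... | yes j≡k = ⊥-elim (j≢k j≡k)
  ... | no _ = refl

  ·-congʳ : ∀ {n} {A A′ : Matrix n} (B : Matrix n) → A ≈ A′ → (A · B) ≈ (A′ · B)
  ·-congʳ {n} B A≈A′ j k = Σ-cong n (λ l → cong (_* B l k) (A≈A′ j l))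

  ·-identityˡ : ∀ {n} (A : Matrix n) → (I · A) ≈ A
  ·-identityˡ {n} A j k = begin
    (I · A) j k    ≡⟨ Σ-supportedAt n (λ l → I j l * A l k) j I-offDiag-term ⟩
    I j j * A j k  ≡⟨ cong (_* A j k) (I-diag j) ⟩
    1# * A j k     ≡⟨ *-identityˡ (A j k) ⟩
    A j k          ∎
    where
    I-offDiag-term : ∀ l → l ≢ j → I j l * A l k ≡ 0#
    I-offDiag-term l l≢j =
      trans (cong (_* A l k) (I-offDiag (λ j≡l → l≢j (sym j≡l)))) (zeroˡ (A l k))

  ·-assoc : ∀ {n} (A B C : Matrix n) → ((A · B) · C) ≈ (A · (B · C))
  ·-assoc {n} A B C j k = begin
    ((A · B) · C) j k                             ≡⟨ Σ≡sum n _ ⟩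
    ∑ (λ l → (A · B) j l * C l k)                 ≡⟨ sum-cong-≗ (λ l → cong (_* C l k) (Σ≡sum n _)) ⟩
    ∑ (λ l → ∑ (λ m → A j m * B m l) * C l k)     ≡⟨ sum-cong-≗ (λ l → *-distribʳ-sum (C l k) (λ m → A j m * B m l)) ⟩
    ∑ (λ l → ∑ (λ m → A j m * B m l * C l k))     ≡⟨ ∑-comm (λ l m → A j m * B m l * C l k) ⟩
    ∑ (λ m → ∑ (λ l → A j m * B m l * C l k))     ≡⟨ sum-cong-≗ (λ m → sum-cong-≗ (λ l → *-assoc (A j m) (B m l) (C l k))) ⟩
    ∑ (λ m → ∑ (λ l → A j m * (B m l * C l k)))   ≡⟨ sum-cong-≗ (λ m → *-distribˡ-sum (A j m) (λ l → B m l * C l k)) ⟨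
    ∑ (λ m → A j m * ∑ (λ l → B m l * C l k))     ≡⟨ sum-cong-≗ (λ m → cong (A j m *_) (Σ≡sum n _)) ⟨
    ∑ (λ m → A j m * (B · C) m k)                 ≡⟨ Σ≡sum n _ ⟨
    (A · (B · C)) j k                             ∎
    where
    ∑ : (Fin n → Carrier) → Carrier
    ∑ = sum

  leftInverse-rowsExceptZero⇒rankOne :
    ∀ {n} {A B X : Matrix n} {i} → (B · A) ≈ I → RowsExcept i Zero (A · X) →
    ∀ j k → X j k ≡ B j i * (A · X) i k
  leftInverse-rowsExceptZero⇒rankOne {n} {A} {B} {X} {i} BA≈I rows j k = begin
    X j k              ≡⟨ ·-identityˡ X j k ⟨
    (I · X) j k        ≡⟨ ·-congʳ X BA≈I j k ⟨
    ((B · A) · X) j k  ≡⟨ ·-assoc B A X j k ⟩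
    (B · (A · X)) j k  ≡⟨ Σ-supportedAt n (λ l → B j l * (A · X) l k) i otherRows≡0 ⟩
    B j i * (A · X) i k ∎
    where
    otherRows≡0 : ∀ l → l ≢ i → B j l * (A · X) l k ≡ 0#
    otherRows≡0 l l≢i = trans (cong (B j l *_) (rows l l≢i k)) (zeroʳ (B j l))

  leftInvertible⇒HasSNIP : ∀ {n} {A B : Matrix n} → (B · A) ≈ I → (i : Fin n) → HasSNIP A i
  leftInvertible⇒HasSNIP {A = A} {B} BA≈I i X symX _ I∘X≈O rows j k = squareZero⇒≡0 (begin
    X j k * X j k              ≡⟨ cong₂ _*_ (X≡bm j k) (trans (symX j k) (X≡bm k j)) ⟩
    (b j * m k) * (b k * m j)  ≡⟨ interchange (b j) (m k) (b k) (m j) ⟩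
    (b j * b k) * (m k * m j)  ≡⟨ cong ((b j * b k) *_) (*-comm (m k) (m j)) ⟩
    (b j * b k) * (m j * m k)  ≡⟨ interchange (b j) (b k) (m j) (m k) ⟩
    (b j * m j) * (b k * m k)  ≡⟨ cong (_* (b k * m k)) (bm-diag≡0 j) ⟩
    0# * (b k * m k)           ≡⟨ zeroˡ (b k * m k) ⟩
    0#                         ∎)
    where
    b m : Fin _ → Carrier
    b l = B l i
    m l = (A · X) i l

    X≡bm : ∀ j k → X j k ≡ b j * m k
    X≡bm = leftInverse-rowsExceptZero⇒rankOne BA≈I rows

    bm-diag≡0 : ∀ j → b j * m j ≡ 0#
    bm-diag≡0 j = begin
      b j * m j      ≡⟨ X≡bm j j ⟨
      X j j          ≡⟨ *-identityˡ (X j j) ⟨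
      1# * X j j     ≡⟨ cong (_* X j j) (I-diag j) ⟨
      I j j * X j j  ≡⟨ I∘X≈O j j ⟩
      0#             ∎

proposition3p2 : (ℝ : RealField) (n : ℕ) (A : Matrices.Matrix ℝ n) →
    Matrices.Symmetric ℝ A → Matrices.Nonsingular ℝ A →
    (i : Fin n) → Matrices.HasSNIP ℝ A i
proposition3p2 ℝ n A _ (B , _ , BA≈I) = MatrixProperties.leftInvertible⇒HasSNIP ℝ BA≈I
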